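{- Let $F_1,\dots,F_n$ be matchings, each of size $n$, in a graph containing no cycle of length $3$ and no cycle of length $5$. Let $R$ be a rainbow matching of maximum possible size $q$, with a fixed injection $\phi:R\to[n]$ satisfying $e\in F_{\phi(e)}$ for all $e\in R$, and let $J=[n]\setminus\phi(R)$. Let $e,f\in R$ be distinct and let $j\in J$ be such that $F_j$ contains edges $g_e,g_f,g_{ef}$ where $g_e$ intersects $e$ and no other edge of $R$, $g_f$ intersects $f$ and no other edge of $R$, and $g_{ef}$ intersects both $e$ and $f$. Suppose $j'\in J$, $j'\ne j$, and $F_{j'}$ contains an edge $g'_e$ intersecting $e$ in one vertex and intersecting no other edge of $R$. Then $g_e\cap g'_e\cap e\neq\emptyset$, i.e. $g_e$ and $g'_e$ meet $e$ at the same vertex.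
   Context: A rainbow matching is a matching $M$ together with an injection $\psi:M\to[n]$ with $x\in F_{\psi(x)}$ for every $x\in M$; "maximum possible size" is over all rainbow matchings. The family $(F_1,\dots,F_n)$ may contain repeated matchings. -}

module Defs where

open import Data.Nat using (ℕ; _≤_)
open import Data.Fin using (Fin; zero; suc)
open import Data.Product using (Σ; ∃; _×_; _,_)
open import Data.Sum using (_⊎_)
open import Relation.Binary.PropositionalEquality using (_≡_; _≢_)
open import Relation.Nullary using (¬_)
open import Function.Definitions using (Injective)

record Graph : Set₁ where
  field
    V      : ℕ
    Adj    : Fin V → Fin V → Set
    sym    : ∀ {u v} → Adj u v → Adj v u
    irrefl : ∀ {v} → ¬ Adj v v

Vertex : Graph → Set
Vertex G = Fin (Graph.V G)

-- An edge {u,v} is given by an ordered pair of its endpoints.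
Edge : Graph → Set
Edge G = Vertex G × Vertex G

IsEdge : (G : Graph) → Edge G → Set
IsEdge G (u , v) = Graph.Adj G u v

_∈ₑ_ : {G : Graph} → Vertex G → Edge G → Set
v ∈ₑ (a , b) = (v ≡ a) ⊎ (v ≡ b)

SameEdge : {G : Graph} → Edge G → Edge G → Set
SameEdge (a , b) (c , d) = ((a ≡ c) × (b ≡ d)) ⊎ ((a ≡ d) × (b ≡ c))

Meets : {G : Graph} → Edge G → Edge G → Set
Meets {G} e f = Σ (Vertex G) λ v → (_∈ₑ_ {G} v e) × (_∈ₑ_ {G} v f)

MeetsInOneVertex : {G : Graph} → Edge G → Edge G → Set
MeetsInOneVertex {G} e f =
  Σ (Vertex G) λ v → (_∈ₑ_ {G} v e) × (_∈ₑ_ {G} v f) ×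
    (∀ w → _∈ₑ_ {G} w e → _∈ₑ_ {G} w f → w ≡ v)

next3 : Fin 3 → Fin 3
next3 zero = suc zero
next3 (suc zero) = suc (suc zero)
next3 (suc (suc zero)) = zero

next5 : Fin 5 → Fin 5
next5 zero = suc zero
next5 (suc zero) = suc (suc zero)
next5 (suc (suc zero)) = suc (suc (suc zero))
next5 (suc (suc (suc zero))) = suc (suc (suc (suc zero)))
next5 (suc (suc (suc (suc zero)))) = zero

HasC3 : Graph → Set
HasC3 G = Σ (Fin 3 → Vertex G) λ c →
  Injective _≡_ _≡_ c × (∀ i → Graph.Adj G (c i) (c (next3 i)))

HasC5 : Graph → Set
HasC5 G = Σ (Fin 5 → Vertex G) λ c →
  Injective _≡_ _≡_ c × (∀ i → Graph.Adj G (c i) (c (next5 i)))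

-- A matching of size m in G: m edges of G, pairwise vertex-disjoint
-- (distinct positions give disjoint, hence distinct, edges).
IsMatching : (G : Graph) {m : ℕ} → (Fin m → Edge G) → Set
IsMatching G {m} M =
  (∀ k → IsEdge G (M k)) × (∀ k l → k ≢ l → ¬ Meets {G} (M k) (M l))

-- A family F₁,…,Fₙ of matchings each of size n: F i k is the k-th edge of F_i.
Family : Graph → ℕ → Set
Family G n = Fin n → Fin n → Edge G

IsMatchingFamily : (G : Graph) (n : ℕ) → Family G n → Set
IsMatchingFamily G n F = ∀ i → IsMatching G (F i)

_∈F_ : {G : Graph} {n : ℕ} → Edge G → (Fin n → Edge G) → Set
_∈F_ {G} {n} e M = Σ (Fin n) λ k → SameEdge {G} e (M k)

IsRainbow : (G : Graph) (n : ℕ) → Family G n →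
            {q : ℕ} → (Fin q → Edge G) → (Fin q → Fin n) → Set
IsRainbow G n F R φ =
  IsMatching G R × Injective _≡_ _≡_ φ × (∀ k → _∈F_ {G} (R k) (F (φ k)))

IsMaxRainbow : (G : Graph) (n : ℕ) → Family G n →
               {q : ℕ} → (Fin q → Edge G) → (Fin q → Fin n) → Set
IsMaxRainbow G n F {q} R φ =
  IsRainbow G n F R φ ×
  (∀ (q' : ℕ) (R' : Fin q' → Edge G) (φ' : Fin q' → Fin n) →
     IsRainbow G n F R' φ' → q' ≤ q)

InJ : {n q : ℕ} → (Fin q → Fin n) → Fin n → Set
InJ φ j = ∀ k → φ k ≢ j

MeetsOnly : {G : Graph} {q : ℕ} → (Fin q → Edge G) → Fin q → Edge G → Set
MeetsOnly {G} R a g = Meets {G} g (R a) × (∀ k → k ≢ a → ¬ Meets {G} g (R k))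

-- If g_e and g'_e met e at different vertices, then, as there are no
-- triangles, g_e and g'_e would be disjoint.  Replacing e by g_e (coloured j)
-- and adding g'_e (coloured j') would then give a rainbow matching of size
-- q + 1, contradicting maximality.
module Submission where

open import Defs
open import Data.Nat using (ℕ; suc)
open import Data.Nat.Properties using (1+n≰n)
open import Data.Fin using (Fin; zero; suc; punchIn)
open import Data.Fin.Properties using (_≟_; punchIn-injective; punchInᵢ≢i)
open import Data.Vec.Functional using (_∷_)
open import Data.Product using (Σ; _×_; _,_; proj₁)
open import Data.Sum using (inj₁; inj₂)
open import Data.Empty using (⊥-elim)
open import Function using (_∘_)
open import Relation.Binary.PropositionalEquality using (_≡_; _≢_; refl; sym; cong)
open import Relation.Nullary using (¬_; Dec; yes; no)
open import Relation.Nullary.Decidable using (map′; _⊎-dec_; _×-dec_)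
open import Function.Definitions using (Injective)

module _ {G : Graph} where

  open Graph G using (Adj; irrefl)

  Meets-sym : {g h : Edge G} → Meets {G} g h → Meets {G} h g
  Meets-sym (v , v∈g , v∈h) = v , v∈h , v∈g

  _∈ₑ?_ : (v : Vertex G) (g : Edge G) → Dec (_∈ₑ_ {G} v g)
  v ∈ₑ? (a , b) = (v ≟ a) ⊎-dec (v ≟ b)

  CommonVertex : Edge G → Edge G → Edge G → Set
  CommonVertex g h k =
    Σ (Vertex G) λ v → _∈ₑ_ {G} v g × _∈ₑ_ {G} v h × _∈ₑ_ {G} v k

  commonVertex? : (g h k : Edge G) → Dec (CommonVertex g h k)
  commonVertex? (a , b) h k =
    map′ endpoint⇒common common⇒endpoint (on a ⊎-dec on b)
    where
      on : (v : Vertex G) → Dec (_∈ₑ_ {G} v h × _∈ₑ_ {G} v k)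
      on v = (v ∈ₑ? h) ×-dec (v ∈ₑ? k)
      endpoint⇒common = λ where
        (inj₁ a∈) → a , inj₁ refl , a∈
        (inj₂ b∈) → b , inj₂ refl , b∈
      common⇒endpoint = λ where
        (_ , inj₁ refl , v∈) → inj₁ v∈
        (_ , inj₂ refl , v∈) → inj₂ v∈

  ∈ₑ-adjacent : ∀ {g a b} → IsEdge G g →
                _∈ₑ_ {G} a g → _∈ₑ_ {G} b g → a ≢ b → Adj a b
  ∈ₑ-adjacent {_ , _} g-edge (inj₁ refl) (inj₁ refl) a≢b = ⊥-elim (a≢b refl)
  ∈ₑ-adjacent {_ , _} g-edge (inj₁ refl) (inj₂ refl) a≢b = g-edge
  ∈ₑ-adjacent {_ , _} g-edge (inj₂ refl) (inj₁ refl) a≢b = Graph.sym G g-edge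
  ∈ₑ-adjacent {_ , _} g-edge (inj₂ refl) (inj₂ refl) a≢b = ⊥-elim (a≢b refl)

  Adj⇒≢ : ∀ {u v} → Adj u v → u ≢ v
  Adj⇒≢ uv refl = irrefl uv

  triangle⇒HasC3 : ∀ {u v w} → Adj u v → Adj v w → Adj w u → HasC3 G
  triangle⇒HasC3 {u} {v} {w} uv vw wu = c , c-injective , c-adjacent
    where
      c : Fin 3 → Vertex G
      c zero             = u
      c (suc zero)       = v
      c (suc (suc zero)) = w

      c-adjacent : ∀ i → Adj (c i) (c (next3 i))
      c-adjacent zero             = uv
      c-adjacent (suc zero)       = vw
      c-adjacent (suc (suc zero)) = wu

      c-injective : Injective _≡_ _≡_ c
      c-injective {zero}             {zero}             _  = refl
      c-injective {zero}             {suc zero}         eq = ⊥-elim (Adj⇒≢ uv eq)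
      c-injective {zero}             {suc (suc zero)}   eq = ⊥-elim (Adj⇒≢ wu (sym eq))
      c-injective {suc zero}         {zero}             eq = ⊥-elim (Adj⇒≢ uv (sym eq))
      c-injective {suc zero}         {suc zero}         _  = refl
      c-injective {suc zero}         {suc (suc zero)}   eq = ⊥-elim (Adj⇒≢ vw eq)
      c-injective {suc (suc zero)}   {zero}             eq = ⊥-elim (Adj⇒≢ wu eq)
      c-injective {suc (suc zero)}   {suc zero}         eq = ⊥-elim (Adj⇒≢ vw (sym eq))
      c-injective {suc (suc zero)}   {suc (suc zero)}   _  = refl

  -- A common vertex v of g and h off e, together with u ∈ g ∩ e and
  -- w ∈ h ∩ e, spans the triangle u w v.
  triangleFree⇒disjoint : ¬ HasC3 G → ∀ {g h e} →
    IsEdge G g → IsEdge G h → IsEdge G e →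
    Meets {G} g e → Meets {G} h e → ¬ CommonVertex g h e → ¬ Meets {G} g h
  triangleFree⇒disjoint noC3 {e = e} g-edge h-edge e-edge
    (u , u∈g , u∈e) (w , w∈h , w∈e) no-common (v , v∈g , v∈h)
    with v ∈ₑ? e
  ... | yes v∈e = no-common (v , v∈g , v∈h , v∈e)
  ... | no  v∉e = noC3 (triangle⇒HasC3 uw wv vu)
    where
      u≢w : u ≢ w
      u≢w refl = no-common (u , u∈g , w∈h , u∈e)
      uw = ∈ₑ-adjacent e-edge u∈e w∈e u≢w
      wv = ∈ₑ-adjacent h-edge w∈h v∈h λ where refl → v∉e w∈e
      vu = ∈ₑ-adjacent g-edge v∈g u∈g λ where refl → v∉e u∈e

module _ {G : Graph} {n : ℕ} {F : Family G n} where

  Rainbow : ℕ → Set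
  Rainbow q = Σ (Fin q → Edge G) λ R → Σ (Fin q → Fin n) λ φ → IsRainbow G n F R φ

  IsMaxRainbow⇒¬Rainbow-suc : ∀ {q} {R : Fin q → Edge G} {φ : Fin q → Fin n} →
    IsMaxRainbow G n F R φ → ¬ Rainbow (suc q)
  IsMaxRainbow⇒¬Rainbow-suc (_ , maximal) (R' , φ' , rainbow') =
    1+n≰n (maximal _ R' φ' rainbow')

  IsRainbow-reindex : ∀ {p q} {R : Fin q → Edge G} {φ : Fin q → Fin n}
    {ρ : Fin p → Fin q} → Injective _≡_ _≡_ ρ →
    IsRainbow G n F R φ → IsRainbow G n F (R ∘ ρ) (φ ∘ ρ)
  IsRainbow-reindex ρ-inj ((R-edges , R-disjoint) , φ-inj , R∈F) =
    (R-edges ∘ _ , λ k l k≢l → R-disjoint _ _ (k≢l ∘ ρ-inj)) ,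
    ρ-inj ∘ φ-inj , R∈F ∘ _

  IsRainbow-∷ : ∀ {q} {R : Fin q → Edge G} {φ : Fin q → Fin n} {g j} →
    IsRainbow G n F R φ → InJ φ j → IsEdge G g → _∈F_ {G} g (F j) →
    (∀ k → ¬ Meets {G} g (R k)) → IsRainbow G n F (g ∷ R) (j ∷ φ)
  IsRainbow-∷ {R = R} {φ} {g} {j} ((R-edges , R-disjoint) , φ-inj , R∈F)
    j∉φ g-edge g∈Fj g-disjoint =
    (edges , disjoint) , injective , member
    where
      edges : ∀ k → IsEdge G ((g ∷ R) k)
      edges zero    = g-edge
      edges (suc k) = R-edges k

      disjoint : ∀ k l → k ≢ l → ¬ Meets {G} ((g ∷ R) k) ((g ∷ R) l)
      disjoint zero    zero    k≢l = ⊥-elim (k≢l refl)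
      disjoint zero    (suc l) _   = g-disjoint l
      disjoint (suc k) zero    _   = g-disjoint k ∘ Meets-sym {G}
      disjoint (suc k) (suc l) k≢l = R-disjoint k l (k≢l ∘ cong suc)

      injective : Injective _≡_ _≡_ (j ∷ φ)
      injective {zero}  {zero}  _  = refl
      injective {zero}  {suc l} eq = ⊥-elim (j∉φ l (sym eq))
      injective {suc k} {zero}  eq = ⊥-elim (j∉φ k eq)
      injective {suc k} {suc l} eq = cong suc (φ-inj eq)

      member : ∀ k → _∈F_ {G} ((g ∷ R) k) (F ((j ∷ φ) k))
      member zero    = g∈Fj
      member (suc k) = R∈F k

  -- Drop R e, then add g (coloured j) and g' (coloured j').
  rainbow-exchange : ∀ {q} {R : Fin q → Edge G} {φ : Fin q → Fin n} →
    IsRainbow G n F R φ → (e : Fin q) →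
    ∀ {g g' j j'} → InJ φ j → InJ φ j' → j' ≢ j →
    IsEdge G g → _∈F_ {G} g (F j) → IsEdge G g' → _∈F_ {G} g' (F j') →
    (∀ k → k ≢ e → ¬ Meets {G} g (R k)) →
    (∀ k → k ≢ e → ¬ Meets {G} g' (R k)) →
    ¬ Meets {G} g' g → Rainbow (suc q)
  rainbow-exchange {suc _} {R} {φ} rainbow e {g} {g'} {j} {j'}
    j∉φ j'∉φ j'≢j g-edge g∈Fj g'-edge g'∈Fj' g-only g'-only g'g-disjoint =
    g' ∷ g ∷ R₀ , j' ∷ j ∷ φ₀ ,
    IsRainbow-∷ (IsRainbow-∷ rainbow₀ (j∉φ ∘ punchIn e) g-edge g∈Fj g-disjoint₀)
      j'∉φ₁ g'-edge g'∈Fj' g'-disjoint₁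
    where
      R₀ = R ∘ punchIn e
      φ₀ = φ ∘ punchIn e
      rainbow₀ = IsRainbow-reindex (punchIn-injective e _ _) rainbow

      g-disjoint₀ : ∀ k → ¬ Meets {G} g (R₀ k)
      g-disjoint₀ k = g-only (punchIn e k) (punchInᵢ≢i e k)

      j'∉φ₁ : InJ (j ∷ φ₀) _
      j'∉φ₁ zero    = j'≢j ∘ sym
      j'∉φ₁ (suc k) = j'∉φ (punchIn e k)

      g'-disjoint₁ : ∀ k → ¬ Meets {G} g' ((g ∷ R₀) k)
      g'-disjoint₁ zero    = g'g-disjoint
      g'-disjoint₁ (suc k) = g'-only (punchIn e k) (punchInᵢ≢i e k)

lemma2p5 : (G : Graph) → ¬ HasC3 G → ¬ HasC5 G →
    (n : ℕ) (F : Family G n) → IsMatchingFamily G n F →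
    (q : ℕ) (R : Fin q → Edge G) (φ : Fin q → Fin n) → IsMaxRainbow G n F R φ →
    (e f : Fin q) → e ≢ f →
    (j : Fin n) → InJ φ j →
    (ge gf gef : Fin n) →
    MeetsOnly {G} R e (F j ge) →
    MeetsOnly {G} R f (F j gf) →
    Meets {G} (F j gef) (R e) → Meets {G} (F j gef) (R f) →
    (j' : Fin n) → InJ φ j' → j' ≢ j →
    (ge' : Fin n) →
    MeetsInOneVertex {G} (F j' ge') (R e) →
    (∀ k → k ≢ e → ¬ Meets {G} (F j' ge') (R k)) →
    Σ (Vertex G) λ v → (_∈ₑ_ {G} v (F j ge)) × (_∈ₑ_ {G} v (F j' ge')) × (_∈ₑ_ {G} v (R e))
lemma2p5 G noC3 _ n F F-matchings q R φ max-rainbow@(rainbow , _) e _ _ j j∉φ ge _ _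
  (g-meets-e , g-only) _ _ _ j' j'∉φ j'≢j ge' (w , w∈g' , w∈e , _) g'-only
  with commonVertex? {G} (F j ge) (F j' ge') (R e)
... | yes common   = common
... | no no-common =
  ⊥-elim (IsMaxRainbow⇒¬Rainbow-suc {G} {n} {F} max-rainbow
    (rainbow-exchange {G} {n} {F} rainbow e j∉φ j'∉φ j'≢j
      g-edge (ge , inj₁ (refl , refl)) g'-edge (ge' , inj₁ (refl , refl))
      g-only g'-only (g-disjoint-g' ∘ Meets-sym {G})))
  where
    g-edge  = proj₁ (F-matchings j) ge
    g'-edge = proj₁ (F-matchings j') ge'
    e-edge  = proj₁ (proj₁ rainbow) e
    g-disjoint-g' = triangleFree⇒disjoint {G} noC3 g-edge g'-edge e-edge
                      g-meets-e (w , w∈g' , w∈e) no-common
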